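{- Let $n\ge 2$. Then \[ \sum_{(a,b,c,d)\in B,\ c\ge d} q^{(a-1)+(b-2)+(c-1)+(d-1)}+\sum_{(a,b,c,d)\in A,\ a<b} q^{(a-1)+(b-2)+(c-1)+(d-1)} =\sum_{\substack{(a,b,c,d)\in\mathbb{Z}^4\\ 1\le a<b\le n+1\\ 1\le d\le c\le n}} q^{(a-1)+(b-2)+(c-1)+(d-1)} ={\genfrac{[}{]}{0pt}{0}{n+1}{2}}_q^{2}, \] where the first two sums run over the location labels of the unit cubes of block $B$ with $c\ge d$ and of block $A$ with $a<b$ respectively.
   Context: $[k]_q=1+q+\cdots+q^{k-1}$, $[k]_q!=\prod_{i=1}^k[i]_q$, $[0]_q!=1$, and ${\genfrac{[}{]}{0pt}{1}{m}{k}}_q=[m]_q!/([k]_q!\,[m-k]_q!)$. For fixed $n\ge 2$, block $A$ is the set of location labels $\{(x,y,z,w)\in\mathbb{Z}^4: 1\le i\le n,\ z=i,\ x,y,w\in\{1,\dots,i\}\}$ and block $B$ is the set of location labels $\{(x,y,z,w)\in\mathbb{Z}^4: 1\le i\le n,\ y=i+1,\ x,z,w\in\{1,\dots,i\}\}$ (each label $(a,b,c,d)$ standing for the unit cube $[a-1,a]\times[b-1,b]\times[c-1,c]\times[d-1,d]$). -}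

module Defs where

open import Data.Nat using (ℕ; zero; suc; _+_; _*_; _∸_; _^_; _≤_; _<_; _≤?_; _<?_; NonZero; >-nonZero; s≤s; z≤n)
open import Data.Nat.DivMod using (_/_)
open import Data.Nat.Properties using (*-mono-≤; m≤m+n)
open import Data.List using (List; []; _∷_; map; upTo; concatMap; filter)
open import Data.Nat.ListAction using (sum)
open import Data.Product using (_×_; _,_)

qint : ℕ → ℕ → ℕ
qint q zero    = 0
qint q (suc k) = qint q k + q ^ k

qfact : ℕ → ℕ → ℕ
qfact q zero    = 1
qfact q (suc k) = qfact q k * qint q (suc k)

qint-pos : ∀ q k → 1 ≤ qint q (suc k)
qint-pos q zero = s≤s z≤n
qint-pos q (suc k) = Data.Nat.Properties.≤-trans (qint-pos q k) (m≤m+n _ _)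

qfact-pos : ∀ q k → 1 ≤ qfact q k
qfact-pos q zero = s≤s z≤n
qfact-pos q (suc k) = *-mono-≤ (qfact-pos q k) (qint-pos q k)

denom-pos : ∀ q m k → 1 ≤ qfact q k * qfact q (m ∸ k)
denom-pos q m k = *-mono-≤ (qfact-pos q k) (qfact-pos q (m ∸ k))

-- q-binomial [m choose k]_q = [m]_q! / ([k]_q! [m-k]_q!)  (exact division)
qbinom : ℕ → ℕ → ℕ → ℕ
qbinom q m k = _/_ (qfact q m) (qfact q k * qfact q (m ∸ k))
                   {{ >-nonZero (denom-pos q m k) }}

Label : Set
Label = ℕ × ℕ × ℕ × ℕ

1to : ℕ → List ℕ
1to n = map suc (upTo n)

blockA : ℕ → List Label
blockA n = concatMap (λ i → concatMap (λ x → concatMap (λ y → map (λ w → (x , y , i , w)) (1to i)) (1to i)) (1to i)) (1to n)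

blockB : ℕ → List Label
blockB n = concatMap (λ i → concatMap (λ x → concatMap (λ z → map (λ w → (x , suc i , z , w)) (1to i)) (1to i)) (1to i)) (1to n)

box : ℕ → List Label
box n = concatMap (λ a → concatMap (λ b → concatMap (λ c → map (λ d → (a , b , c , d)) (1to n)) (1to n)) (1to (suc n))) (1to (suc n))

-- weight q^{(a-1)+(b-2)+(c-1)+(d-1)}  (b ≥ 2 in all sums considered)
wt : ℕ → Label → ℕ
wt q (a , b , c , d) = q ^ ((a ∸ 1) + (b ∸ 2) + (c ∸ 1) + (d ∸ 1))

sumW : ℕ → List Label → ℕ
sumW q ls = sum (map (wt q) ls)

c≥d : (t : Label) → _
c≥d (a , b , c , d) = d ≤? c

a<b : (t : Label) → _
a<b (a , b , c , d) = a <? b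

a<b∧d≤c : (t : Label) → _
a<b∧d≤c (a , b , c , d) = Relation.Nullary.Decidable._×-dec_ (a <? b) (d ≤? c)
  where import Relation.Nullary.Decidable

-- Let T n = Σ_{i<n} q^i [i+1]_q = Σ_{0≤d≤c<n} q^(c+d), which is also Σ_{0≤a<b≤n} q^(a+b-1).
-- The box sum is the product of these two pair sums, i.e. T n².  Layer i of block B
-- contributes q^i [i+1]_q · T (i+1) and layer i of block A contributes T i · q^i [i+1]_q;
-- since T (i+1) = T i + q^i [i+1]_q, the two layers tile the shell T (i+1)² − T i².
-- Finally (1+q) T n = [n]_q [n+1]_q identifies T n with the q-binomial coefficient.
module Submission where

open import Defs
open import Data.Nat using (ℕ; suc; _^_; _+_; _≤_)
open import Data.List using (filter)
open import Data.Product using (_×_)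
open import Relation.Binary.PropositionalEquality using (_≡_)

open import Data.Bool using (true; false; if_then_else_; _∧_)
open import Data.Bool.Properties using (if-float; if-cong-then)
open import Data.Fin using (toℕ)
open import Data.Fin.Properties using (toℕ<n; toℕ-fromℕ; toℕ-inject₁)
open import Data.List using (List; []; _∷_; map; applyUpTo; concatMap; _++_)
open import Data.List.Properties using (map-++; map-∘; map-applyUpTo)
open import Data.Nat using (zero; _*_; _∸_; _<_; _<ᵇ_; s≤s; z≤n; NonZero; >-nonZero)
open import Data.Nat.DivMod using (_/_; /-congˡ; m*n/n≡m)
open import Data.Nat.ListAction using (sum)
open import Data.Nat.ListAction.Properties using (sum-++)
open import Data.Nat.Properties using (+-*-semiring; +-assoc; +-comm; +-identityʳ; *-assoc; *-distribˡ-+; *-zeroʳ; *-identityʳ; <⇒≤; ^-distribˡ-+-*)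
open import Data.Nat.Solver using (module +-*-Solver)
open import Data.Product using (_,_)
open import Function using (_∘_; id)
open import Relation.Nullary using (does)
open import Relation.Unary using (Decidable)
open import Relation.Binary.PropositionalEquality using (refl; sym; trans; cong; cong₂; module ≡-Reasoning)
open import Algebra.Properties.Semiring.Sum +-*-semiring
  using (sum-cong-≗; sum-replicate-zero; sum-init-last; ∑-comm; ∑-distrib-+; *-distribˡ-sum; *-distribʳ-sum)
  renaming (sum to sumᶠ)

open +-*-Solver
open ≡-Reasoning

∑ : ℕ → (ℕ → ℕ) → ℕ
∑ n f = sumᶠ {n} (f ∘ toℕ)

∑-cong : ∀ n {f g : ℕ → ℕ} → (∀ k → f k ≡ g k) → ∑ n f ≡ ∑ n g
∑-cong n f≗g = sum-cong-≗ {n} (f≗g ∘ toℕ)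

∑-cong-< : ∀ n {f g : ℕ → ℕ} → (∀ k → k < n → f k ≡ g k) → ∑ n f ≡ ∑ n g
∑-cong-< n f≗g = sum-cong-≗ {n} (λ i → f≗g (toℕ i) (toℕ<n i))

∑-swap : ∀ m n (f : ℕ → ℕ → ℕ) → ∑ m (λ i → ∑ n (f i)) ≡ ∑ n (λ j → ∑ m (λ i → f i j))
∑-swap m n f = ∑-comm {m} {n} (λ i j → f (toℕ i) (toℕ j))

∑-+ : ∀ n (f g : ℕ → ℕ) → ∑ n (λ k → f k + g k) ≡ ∑ n f + ∑ n g
∑-+ n f g = ∑-distrib-+ {n} (f ∘ toℕ) (g ∘ toℕ)

∑-*ˡ : ∀ n c (f : ℕ → ℕ) → ∑ n (λ k → c * f k) ≡ c * ∑ n f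
∑-*ˡ n c f = sym (*-distribˡ-sum {n} c (f ∘ toℕ))

∑-*ʳ : ∀ n c (f : ℕ → ℕ) → ∑ n (λ k → f k * c) ≡ ∑ n f * c
∑-*ʳ n c f = sym (*-distribʳ-sum {n} c (f ∘ toℕ))

∑-snoc : ∀ n (f : ℕ → ℕ) → ∑ (suc n) f ≡ ∑ n f + f n
∑-snoc n f = trans (sum-init-last {n} (f ∘ toℕ))
  (cong₂ _+_ (sum-cong-≗ {n} (cong f ∘ toℕ-inject₁)) (cong f (toℕ-fromℕ n)))

∑-restrict : ∀ {b m} → b ≤ m → (f : ℕ → ℕ) → ∑ m (λ k → if k <ᵇ b then f k else 0) ≡ ∑ b f
∑-restrict {m = m} z≤n f = sum-replicate-zero m
∑-restrict (s≤s b≤m) f = cong (f 0 +_) (∑-restrict b≤m (f ∘ suc))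

∑²-*ˡ : ∀ m n c (f : ℕ → ℕ → ℕ) → ∑ m (λ i → ∑ n (λ j → c * f i j)) ≡ c * ∑ m (λ i → ∑ n (f i))
∑²-*ˡ m n c f = trans (∑-cong m (λ i → ∑-*ˡ n c (f i))) (∑-*ˡ m c (λ i → ∑ n (f i)))

∑²-*ʳ : ∀ m n c (f : ℕ → ℕ → ℕ) → ∑ m (λ i → ∑ n (λ j → f i j * c)) ≡ ∑ m (λ i → ∑ n (f i)) * c
∑²-*ʳ m n c f = trans (∑-cong m (λ i → ∑-*ʳ n c (f i))) (∑-*ʳ m c (λ i → ∑ n (f i)))

∑-shells : ∀ (δ : ℕ → ℕ) n → ∑ n (λ i → δ i * ∑ (suc i) δ + ∑ i δ * δ i) ≡ ∑ n δ * ∑ n δ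
∑-shells δ zero = refl
∑-shells δ (suc n) = begin
    ∑ (suc n) shell
  ≡⟨ ∑-snoc n shell ⟩
    ∑ n shell + shell n
  ≡⟨ cong₂ _+_ (∑-shells δ n) (cong (λ s → δ n * s + S * δ n) (∑-snoc n δ)) ⟩
    S * S + (δ n * (S + δ n) + S * δ n)
  ≡⟨ solve 2 (λ s d → s :* s :+ (d :* (s :+ d) :+ s :* d) := (s :+ d) :* (s :+ d)) refl S (δ n) ⟩
    (S + δ n) * (S + δ n)
  ≡⟨ cong (λ s → s * s) (∑-snoc n δ) ⟨
    ∑ (suc n) δ * ∑ (suc n) δ
  ∎
  where
  S : ℕ
  S = ∑ n δ
  shell : ℕ → ℕ
  shell i = δ i * ∑ (suc i) δ + ∑ i δ * δ i

sum-map-applyUpTo : ∀ {A : Set} (f : A → ℕ) (g : ℕ → A) n → sum (map f (applyUpTo g n)) ≡ ∑ n (f ∘ g)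
sum-map-applyUpTo f g zero = refl
sum-map-applyUpTo f g (suc n) = cong (f (g 0) +_) (sum-map-applyUpTo f (g ∘ suc) n)

sum-map-1to : ∀ (f : ℕ → ℕ) n → sum (map f (1to n)) ≡ ∑ n (f ∘ suc)
sum-map-1to f n = trans (cong (sum ∘ map f) (map-applyUpTo id suc n)) (sum-map-applyUpTo f suc n)

sum-map-concatMap : ∀ {A B : Set} (f : B → ℕ) (g : A → List B) xs →
  sum (map f (concatMap g xs)) ≡ sum (map (λ x → sum (map f (g x))) xs)
sum-map-concatMap f g [] = refl
sum-map-concatMap f g (x ∷ xs) = begin
    sum (map f (g x ++ concatMap g xs))
  ≡⟨ cong sum (map-++ f (g x) (concatMap g xs)) ⟩
    sum (map f (g x) ++ map f (concatMap g xs))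
  ≡⟨ sum-++ (map f (g x)) (map f (concatMap g xs)) ⟩
    sum (map f (g x)) + sum (map f (concatMap g xs))
  ≡⟨ cong (sum (map f (g x)) +_) (sum-map-concatMap f g xs) ⟩
    sum (map (λ x → sum (map f (g x))) (x ∷ xs))
  ∎

sum-map-filter : ∀ {A : Set} {P : A → Set} (P? : Decidable P) (f : A → ℕ) xs →
  sum (map f (filter P? xs)) ≡ sum (map (λ x → if does (P? x) then f x else 0) xs)
sum-map-filter P? f [] = refl
sum-map-filter P? f (x ∷ xs) with does (P? x)
... | true  = cong (f x +_) (sum-map-filter P? f xs)
... | false = sum-map-filter P? f xs

sum-map-comprehension : ∀ {A : Set} (f : A → ℕ) (label : ℕ → ℕ → ℕ → ℕ → A) (r₂ r₃ r₄ : ℕ → ℕ) n →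
  sum (map f (concatMap (λ a → concatMap (λ b → concatMap (λ c → map (λ d → label a b c d)
    (1to (r₄ a))) (1to (r₃ a))) (1to (r₂ a))) (1to n)))
  ≡ ∑ n (λ a → ∑ (r₂ (suc a)) (λ b → ∑ (r₃ (suc a)) (λ c → ∑ (r₄ (suc a)) (λ d →
      f (label (suc a) (suc b) (suc c) (suc d))))))
sum-map-comprehension {A} f label r₂ r₃ r₄ n =
  trans (sum-concatMap-1to (λ a → concatMap (λ b → concatMap (λ c → map (label a b c)
          (1to (r₄ a))) (1to (r₃ a))) (1to (r₂ a))) n) (∑-cong n λ a →
  trans (sum-concatMap-1to (λ b → concatMap (λ c → map (label (suc a) b c)
          (1to (r₄ (suc a)))) (1to (r₃ (suc a)))) (r₂ (suc a))) (∑-cong (r₂ (suc a)) λ b →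
  trans (sum-concatMap-1to (λ c → map (label (suc a) (suc b) c) (1to (r₄ (suc a)))) (r₃ (suc a)))
  (∑-cong (r₃ (suc a)) λ c →
  trans (cong sum (sym (map-∘ (1to (r₄ (suc a)))))) (sum-map-1to (f ∘ label (suc a) (suc b) (suc c)) (r₄ (suc a))))))
  where
  sum-concatMap-1to : ∀ (g : ℕ → List A) m → sum (map f (concatMap g (1to m))) ≡ ∑ m (λ k → sum (map f (g (suc k))))
  sum-concatMap-1to g m = trans (sum-map-concatMap f g (1to m)) (sum-map-1to (λ k → sum (map f (g k))) m)

if-*ˡ : ∀ b x y → (if b then x * y else 0) ≡ x * (if b then y else 0)
if-*ˡ true  x y = refl
if-*ˡ false x y = sym (*-zeroʳ x)

if-∧-* : ∀ b c x y → (if b ∧ c then x * y else 0) ≡ (if b then x else 0) * (if c then y else 0)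
if-∧-* true  c x y = if-*ˡ c x y
if-∧-* false c x y = refl

module _ (q : ℕ) where

  ^-+⁴ : ∀ s t u v → q ^ (s + t + u + v) ≡ q ^ (s + t) * q ^ (u + v)
  ^-+⁴ s t u v = trans (cong (q ^_) (+-assoc (s + t) u v)) (^-distribˡ-+-* q (s + t) (u + v))

  ∑-pow≡qint : ∀ n → ∑ n (q ^_) ≡ qint q n
  ∑-pow≡qint zero    = refl
  ∑-pow≡qint (suc n) = trans (∑-snoc n (q ^_)) (cong (_+ q ^ n) (∑-pow≡qint n))

  ∑-pow-+ : ∀ n s → ∑ n (λ k → q ^ (s + k)) ≡ q ^ s * qint q n
  ∑-pow-+ n s = begin
      ∑ n (λ k → q ^ (s + k))
    ≡⟨ ∑-cong n (^-distribˡ-+-* q s) ⟩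
      ∑ n (λ k → q ^ s * q ^ k)
    ≡⟨ ∑-*ˡ n (q ^ s) (q ^_) ⟩
      q ^ s * ∑ n (q ^_)
    ≡⟨ cong (q ^ s *_) (∑-pow≡qint n) ⟩
      q ^ s * qint q n
    ∎

  qtri-step : ℕ → ℕ
  qtri-step i = q ^ i * qint q (suc i)

  qtri : ℕ → ℕ
  qtri n = ∑ n qtri-step

  [1+q]*qtri : ∀ n → suc q * qtri n ≡ qint q n * qint q (suc n)
  [1+q]*qtri zero    = *-zeroʳ (suc q)
  [1+q]*qtri (suc n) = begin
      suc q * qtri (suc n)
    ≡⟨ cong (suc q *_) (∑-snoc n qtri-step) ⟩
      suc q * (qtri n + qtri-step n)
    ≡⟨ *-distribˡ-+ (suc q) (qtri n) (qtri-step n) ⟩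
      suc q * qtri n + suc q * qtri-step n
    ≡⟨ cong (_+ suc q * qtri-step n) ([1+q]*qtri n) ⟩
      qint q n * qint q (suc n) + suc q * (q ^ n * qint q (suc n))
    ≡⟨ solve 3 (λ t p r → t :* (t :+ p) :+ (con 1 :+ r) :* (p :* (t :+ p))
                       := (t :+ p) :* ((t :+ p) :+ r :* p)) refl (qint q n) (q ^ n) q ⟩
      qint q (suc n) * qint q (suc (suc n))
    ∎

  qtri≡qbinom : ∀ m → qtri (suc m) ≡ qbinom q (suc (suc m)) 2
  qtri≡qbinom m = sym (begin
      qbinom q (suc (suc m)) 2
    ≡⟨ /-congˡ qfact≡qtri*denominator ⟩
      qtri (suc m) * denominator / denominator
    ≡⟨ m*n/n≡m (qtri (suc m)) denominator ⟩
      qtri (suc m)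
    ∎)
    where
    denominator : ℕ
    denominator = qfact q 2 * qfact q m

    instance
      denominator-nonZero : NonZero denominator
      denominator-nonZero = >-nonZero (denom-pos q (suc (suc m)) 2)

    qfact-2 : qfact q 2 ≡ suc q
    qfact-2 = cong suc (trans (+-identityʳ (q * 1)) (*-identityʳ q))

    qfact≡qtri*denominator : qfact q (suc (suc m)) ≡ qtri (suc m) * denominator
    qfact≡qtri*denominator = begin
        qfact q m * qint q (suc m) * qint q (suc (suc m))
      ≡⟨ *-assoc (qfact q m) _ _ ⟩
        qfact q m * (qint q (suc m) * qint q (suc (suc m)))
      ≡⟨ cong (qfact q m *_) ([1+q]*qtri (suc m)) ⟨
        qfact q m * (suc q * qtri (suc m))
      ≡⟨ solve 3 (λ f r t → f :* (r :* t) := t :* (r :* f)) refl (qfact q m) (suc q) (qtri (suc m)) ⟩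
        qtri (suc m) * (suc q * qfact q m)
      ≡⟨ cong (λ r → qtri (suc m) * (r * qfact q m)) qfact-2 ⟨
        qtri (suc m) * denominator
      ∎

  wt< : ℕ → ℕ → ℕ
  wt< a b = if a <ᵇ b then q ^ (a + (b ∸ 1)) else 0

  wt≥ : ℕ → ℕ → ℕ
  wt≥ c d = if d <ᵇ suc c then q ^ (c + d) else 0

  ∑-wt< : ∀ n → ∑ (suc n) (λ a → ∑ (suc n) (wt< a)) ≡ qtri n
  ∑-wt< n = begin
      ∑ (suc n) (λ a → ∑ (suc n) (wt< a))
    ≡⟨ ∑-swap (suc n) (suc n) wt< ⟩
      ∑ (suc n) (λ b → ∑ (suc n) (λ a → wt< a b))
    ≡⟨ ∑-cong-< (suc n) (λ b b<1+n → ∑-restrict (<⇒≤ b<1+n) (λ a → q ^ (a + (b ∸ 1)))) ⟩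
      ∑ (suc n) (λ b → ∑ b (λ a → q ^ (a + (b ∸ 1))))
    ≡⟨ ∑-cong (suc n) (λ b → trans (∑-cong b (λ a → cong (q ^_) (+-comm a (b ∸ 1)))) (∑-pow-+ b (b ∸ 1))) ⟩
      ∑ (suc n) (λ b → q ^ (b ∸ 1) * qint q b)
    ≡⟨⟩  -- the term b = 0 carries the factor [0]_q = 0
      qtri n
    ∎

  ∑-wt≥ : ∀ n → ∑ n (λ c → ∑ n (wt≥ c)) ≡ qtri n
  ∑-wt≥ n = ∑-cong-< n (λ c c<n → trans (∑-restrict c<n (λ d → q ^ (c + d))) (∑-pow-+ (suc c) c))

  ∑-layerB : ∀ i → ∑ (suc i) (λ x → ∑ (suc i) (λ z → ∑ (suc i) (λ w →
                     if w <ᵇ suc z then q ^ (x + i + z + w) else 0)))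
                 ≡ qtri-step i * qtri (suc i)
  ∑-layerB i = begin
      ∑ (suc i) (λ x → ∑ (suc i) (λ z → ∑ (suc i) (λ w → if w <ᵇ suc z then q ^ (x + i + z + w) else 0)))
    ≡⟨ ∑-cong (suc i) (λ x → ∑-cong (suc i) (λ z → ∑-cong (suc i) (λ w →
         trans (if-cong-then (w <ᵇ suc z) (^-+⁴ x i z w)) (if-*ˡ (w <ᵇ suc z) (q ^ (x + i)) (q ^ (z + w)))))) ⟩
      ∑ (suc i) (λ x → ∑ (suc i) (λ z → ∑ (suc i) (λ w → q ^ (x + i) * wt≥ z w)))
    ≡⟨ ∑-cong (suc i) (λ x → ∑²-*ˡ (suc i) (suc i) (q ^ (x + i)) wt≥) ⟩
      ∑ (suc i) (λ x → q ^ (x + i) * ∑ (suc i) (λ z → ∑ (suc i) (wt≥ z)))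
    ≡⟨ ∑-*ʳ (suc i) _ (λ x → q ^ (x + i)) ⟩
      ∑ (suc i) (λ x → q ^ (x + i)) * ∑ (suc i) (λ z → ∑ (suc i) (wt≥ z))
    ≡⟨ cong₂ _*_ (trans (∑-cong (suc i) (λ x → cong (q ^_) (+-comm x i))) (∑-pow-+ (suc i) i)) (∑-wt≥ (suc i)) ⟩
      qtri-step i * qtri (suc i)
    ∎

  ∑-layerA : ∀ i → ∑ (suc i) (λ x → ∑ (suc i) (λ y → ∑ (suc i) (λ w →
                     if x <ᵇ y then q ^ (x + (y ∸ 1) + i + w) else 0)))
                 ≡ qtri i * qtri-step i
  ∑-layerA i = begin
      ∑ (suc i) (λ x → ∑ (suc i) (λ y → ∑ (suc i) (λ w → if x <ᵇ y then q ^ (x + (y ∸ 1) + i + w) else 0)))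
    ≡⟨ ∑-cong (suc i) (λ x → ∑-cong (suc i) (λ y → ∑-cong (suc i) (λ w →
         trans (if-cong-then (x <ᵇ y) (^-+⁴ x (y ∸ 1) i w)) (sym (if-float (_* q ^ (i + w)) (x <ᵇ y) {q ^ (x + (y ∸ 1))} {0}))))) ⟩
      ∑ (suc i) (λ x → ∑ (suc i) (λ y → ∑ (suc i) (λ w → wt< x y * q ^ (i + w))))
    ≡⟨ ∑-cong (suc i) (λ x → ∑-cong (suc i) (λ y → ∑-*ˡ (suc i) (wt< x y) (λ w → q ^ (i + w)))) ⟩
      ∑ (suc i) (λ x → ∑ (suc i) (λ y → wt< x y * ∑ (suc i) (λ w → q ^ (i + w))))
    ≡⟨ ∑²-*ʳ (suc i) (suc i) _ wt< ⟩
      ∑ (suc i) (λ x → ∑ (suc i) (wt< x)) * ∑ (suc i) (λ w → q ^ (i + w))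
    ≡⟨ cong₂ _*_ (∑-wt< i) (∑-pow-+ (suc i) i) ⟩
      qtri i * qtri-step i
    ∎

  ∑-box : ∀ n → ∑ (suc n) (λ a → ∑ (suc n) (λ b → ∑ n (λ c → ∑ n (λ d →
                  if (a <ᵇ b) ∧ (d <ᵇ suc c) then q ^ (a + (b ∸ 1) + c + d) else 0))))
              ≡ qtri n * qtri n
  ∑-box n = begin
      ∑ (suc n) (λ a → ∑ (suc n) (λ b → ∑ n (λ c → ∑ n (λ d →
        if (a <ᵇ b) ∧ (d <ᵇ suc c) then q ^ (a + (b ∸ 1) + c + d) else 0))))
    ≡⟨ ∑-cong (suc n) (λ a → ∑-cong (suc n) (λ b → ∑-cong n (λ c → ∑-cong n (λ d →
         trans (if-cong-then ((a <ᵇ b) ∧ (d <ᵇ suc c)) (^-+⁴ a (b ∸ 1) c d)) (if-∧-* (a <ᵇ b) (d <ᵇ suc c) (q ^ (a + (b ∸ 1))) (q ^ (c + d))))))) ⟩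
      ∑ (suc n) (λ a → ∑ (suc n) (λ b → ∑ n (λ c → ∑ n (λ d → wt< a b * wt≥ c d))))
    ≡⟨ ∑-cong (suc n) (λ a → ∑-cong (suc n) (λ b → ∑²-*ˡ n n (wt< a b) wt≥)) ⟩
      ∑ (suc n) (λ a → ∑ (suc n) (λ b → wt< a b * ∑ n (λ c → ∑ n (wt≥ c))))
    ≡⟨ ∑²-*ʳ (suc n) (suc n) _ wt< ⟩
      ∑ (suc n) (λ a → ∑ (suc n) (wt< a)) * ∑ n (λ c → ∑ n (wt≥ c))
    ≡⟨ cong₂ _*_ (∑-wt< n) (∑-wt≥ n) ⟩
      qtri n * qtri n
    ∎

  sumW-blockB : ∀ n → sumW q (filter c≥d (blockB n)) ≡
    ∑ n (λ i → ∑ (suc i) (λ x → ∑ (suc i) (λ z → ∑ (suc i) (λ w → if w <ᵇ suc z then q ^ (x + i + z + w) else 0))))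
  sumW-blockB n = trans (sum-map-filter c≥d (wt q) (blockB n))
    (sum-map-comprehension _ (λ i x z w → (x , suc i , z , w)) id id id n)

  sumW-blockA : ∀ n → sumW q (filter a<b (blockA n)) ≡
    ∑ n (λ i → ∑ (suc i) (λ x → ∑ (suc i) (λ y → ∑ (suc i) (λ w → if x <ᵇ y then q ^ (x + (y ∸ 1) + i + w) else 0))))
  sumW-blockA n = trans (sum-map-filter a<b (wt q) (blockA n))
    (sum-map-comprehension _ (λ i x y w → (x , y , i , w)) id id id n)

  sumW-box : ∀ n → sumW q (filter a<b∧d≤c (box n)) ≡ qtri n * qtri n
  sumW-box n = trans (sum-map-filter a<b∧d≤c (wt q) (box n))
    (trans (sum-map-comprehension _ (λ a b c d → (a , b , c , d)) (λ _ → suc n) (λ _ → n) (λ _ → n) (suc n)) (∑-box n))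

lemma20 : (n : ℕ) → 2 ≤ n → (q : ℕ) →
    (sumW q (filter c≥d (blockB n)) + sumW q (filter a<b (blockA n))
      ≡ sumW q (filter a<b∧d≤c (box n)))
    × (sumW q (filter a<b∧d≤c (box n)) ≡ qbinom q (suc n) 2 ^ 2)
lemma20 zero () q
-- n ≥ 1 suffices: it is needed only to identify qtri n with the q-binomial
lemma20 n@(suc m) _ q = blocks≡box , box≡qbinom²
  where
  box≡qbinom² : sumW q (filter a<b∧d≤c (box n)) ≡ qbinom q (suc n) 2 ^ 2
  box≡qbinom² = begin
      sumW q (filter a<b∧d≤c (box n))
    ≡⟨ sumW-box q n ⟩
      qtri q n * qtri q n
    ≡⟨ cong (λ t → t * t) (qtri≡qbinom q m) ⟩
      qbinom q (suc n) 2 * qbinom q (suc n) 2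
    ≡⟨ cong (qbinom q (suc n) 2 *_) (*-identityʳ _) ⟨
      qbinom q (suc n) 2 ^ 2
    ∎

  blocks≡box : sumW q (filter c≥d (blockB n)) + sumW q (filter a<b (blockA n))
               ≡ sumW q (filter a<b∧d≤c (box n))
  blocks≡box = begin
      sumW q (filter c≥d (blockB n)) + sumW q (filter a<b (blockA n))
    ≡⟨ cong₂ _+_ (trans (sumW-blockB q n) (∑-cong n (∑-layerB q)))
                 (trans (sumW-blockA q n) (∑-cong n (∑-layerA q))) ⟩
      ∑ n (λ i → qtri-step q i * qtri q (suc i)) + ∑ n (λ i → qtri q i * qtri-step q i)
    ≡⟨ ∑-+ n (λ i → qtri-step q i * qtri q (suc i)) (λ i → qtri q i * qtri-step q i) ⟨
      ∑ n (λ i → qtri-step q i * qtri q (suc i) + qtri q i * qtri-step q i)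
    ≡⟨ ∑-shells (qtri-step q) n ⟩
      qtri q n * qtri q n
    ≡⟨ sumW-box q n ⟨
      sumW q (filter a<b∧d≤c (box n))
    ∎
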